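{- For any positive polarized formula $P$ and any unpolarized structure $\Gamma$: if $\Gamma,|\Sigma|\vdash$ is derivable for all $\Sigma\in\mathrm{inv}(P)$, then $\Gamma,|P|\vdash$ is derivable. That is, the rule inferring $\Gamma,|P|\vdash$ from the premises $\{\Gamma,|\Sigma|\vdash\}_{\Sigma\in\mathrm{inv}(P)}$ is admissible for unpolarized $\mathbf{LG}_\emptyset$, and hence for $\mathbf{LG}_I$ and $\mathbf{CNL}$.
   Context: Notation: $\otimes$ tensor, $\oplus$ par, $/,\backslash$ implications, $\oslash$ right coimplication, $\ominus$ left coimplication (circled slash / circled backslash in the source); $\mathbin{\cdot\otimes\cdot},\mathbin{\cdot\oslash\cdot},\mathbin{\cdot\ominus\cdot}$ are their structural counterparts. Unpolarized calculus $\mathbf{LG}_\emptyset$: formulas $A ::= p\mid\bar p\mid A\otimes B\mid B\oplus A\mid A/B\mid B\ominus A\mid B\backslash A\mid A\oslash B\mid A\land B\mid A\lor B$; structures $\Gamma ::= A\mid\Gamma\mathbin{\cdot\otimes\cdot}\Delta\mid\Gamma\mathbin{\cdot\oslash\cdot}\Delta\mid\Delta\mathbin{\cdot\ominus\cdot}\Gamma$; rules include (Ax) $A,A^\bot\vdash$, (Cut), display postulates $\Gamma,\Delta\vdash$ iff $\Delta,\Gamma\vdash$, $\Gamma\mathbin{\cdot\otimes\cdot}\Delta,\Theta\vdash$ iff $\Gamma,\Delta\mathbin{\cdot\ominus\cdot}\Theta\vdash$, $\Gamma,\Delta\mathbin{\cdot\otimes\cdot}\Theta\vdash$ iff $\Gamma\mathbin{\cdot\oslash\cdot}\Delta,\Theta\vdash$;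 ($\otimes$) from $\Gamma,A\mathbin{\cdot\otimes\cdot}B\vdash$ infer $\Gamma,A\otimes B\vdash$; ($\ominus$) from $\Gamma,B^\bot\mathbin{\cdot\ominus\cdot}A\vdash$ infer $\Gamma,B\ominus A\vdash$; ($\oslash$) from $\Gamma,A\mathbin{\cdot\oslash\cdot}B^\bot\vdash$ infer $\Gamma,A\oslash B\vdash$; ($\lor$) from $\Gamma,A\vdash$ and $\Gamma,B\vdash$ infer $\Gamma,A\lor B\vdash$; plus rules for $\oplus,/,\backslash,\land$. $\mathbf{LG}_I$ and $\mathbf{CNL}$ extend $\mathbf{LG}_\emptyset$ with structural rules. Polarized formulas: $P,Q ::= p\mid P\otimes Q\mid P\oslash N\mid N\ominus P\mid P\lor Q\mid{\downarrow}N$, $N,M ::= \bar p\mid M\oplus N\mid Q\backslash M\mid M/Q\mid M\land N\mid{\uparrow}P$, with linear negation ($p^\bot=\bar p$, $(P\otimes Q)^\bot=Q^\bot\oplus P^\bot$, $(N\ominus P)^\bot=P^\bot/N^\bot$, $(P\oslash N)^\bot=N^\bot\backslash P^\bot$, $(P\lor Q)^\bot=Q^\bot\land P^\bot$, $({\downarrow}N)^\bot={\uparrow}N^\bot$, and converses). Focused structures (relative to a fixed set $X$ of negative formulas) $\Pi,\Sigma ::= p\mid N\mid\Pi\mathbin{\cdot\otimes\cdot}\Sigma\mid\Pi\mathbin{\cdot\oslash\cdot}\Sigma\mid\Sigma\mathbin{\cdot\ominus\cdot}\Pi$. $\mathrm{inv}(P)$: $\mathrm{inv}(p)=\{p\}$,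 $\mathrm{inv}({\downarrow}N)=\{N\}$, $\mathrm{inv}(P\lor Q)=\mathrm{inv}(P)\cup\mathrm{inv}(Q)$, $\mathrm{inv}(P\otimes Q)=\{\Pi\mathbin{\cdot\otimes\cdot}\Sigma\mid\Pi\in\mathrm{inv}(P),\Sigma\in\mathrm{inv}(Q)\}$, $\mathrm{inv}(P\oslash N)=\{\Pi\mathbin{\cdot\oslash\cdot}\Sigma\mid\Pi\in\mathrm{inv}(P),\Sigma\in\mathrm{inv}(N^\bot)\}$, $\mathrm{inv}(N\ominus P)=\{\Sigma\mathbin{\cdot\ominus\cdot}\Pi\mid\Pi\in\mathrm{inv}(P),\Sigma\in\mathrm{inv}(N^\bot)\}$. Forgetful map $|\cdot|$ into unpolarized formulas: $|p|=p$, $|\bar p|=\bar p$, $|P\otimes Q|=|P|\otimes|Q|$, $|N\ominus P|=|N|\ominus|P|$, $|P\oslash N|=|P|\oslash|N|$, $|P\lor Q|=|P|\lor|Q|$, $|{\downarrow}N|=|N|$, and dually for negatives ($|M\oplus N|=|M|\oplus|N|$, $|M/Q|=|M|/|Q|$, $|Q\backslash M|=|Q|\backslash|M|$, $|M\land N|=|M|\land|N|$, $|{\uparrow}P|=|P|$); on focused structures, $|\Sigma|$ replaces each occurrence of $N$ by $|N|$ and leaves positive atoms intact. -}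

module Defs where

infixr 30 _⊗_ _⊕_ _⊘_ _⊖_ _/_ _⧵_ _∧_ _∨_

data Fm (At : Set) : Set where
  at   : At → Fm At
  nat  : At → Fm At
  _⊗_  : Fm At → Fm At → Fm At
  _⊕_  : Fm At → Fm At → Fm At
  _/_  : Fm At → Fm At → Fm At
  _⊖_  : Fm At → Fm At → Fm At
  _⧵_  : Fm At → Fm At → Fm At
  _⊘_  : Fm At → Fm At → Fm At
  _∧_  : Fm At → Fm At → Fm At
  _∨_  : Fm At → Fm At → Fm At

_ᗮ : ∀ {At} → Fm At → Fm At
at p ᗮ    = nat p
nat p ᗮ   = at p
(A ⊗ B) ᗮ = (B ᗮ) ⊕ (A ᗮ)
(A ⊕ B) ᗮ = (B ᗮ) ⊗ (A ᗮ)
(B ⊖ A) ᗮ = (A ᗮ) / (B ᗮ)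
(A / B) ᗮ = (B ᗮ) ⊖ (A ᗮ)
(A ⊘ B) ᗮ = (B ᗮ) ⧵ (A ᗮ)
(B ⧵ A) ᗮ = (A ᗮ) ⊘ (B ᗮ)
(A ∨ B) ᗮ = (B ᗮ) ∧ (A ᗮ)
(A ∧ B) ᗮ = (B ᗮ) ∨ (A ᗮ)

infixr 25 _·⊗·_ _·⊘·_ _·⊖·_

data Str (At : Set) : Set where
  ⌊_⌋    : Fm At → Str At
  _·⊗·_  : Str At → Str At → Str At
  _·⊘·_  : Str At → Str At → Str At
  _·⊖·_  : Str At → Str At → Str At

infix 10 _⨾_⊢

-- derivability of the one-sided sequent  Γ , Δ ⊢  in LG_∅
data _⨾_⊢ {At : Set} : Str At → Str At → Set where
  ax   : ∀ A → ⌊ A ⌋ ⨾ ⌊ A ᗮ ⌋ ⊢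
  cut  : ∀ {Γ Δ} A → Γ ⨾ ⌊ A ⌋ ⊢ → ⌊ A ᗮ ⌋ ⨾ Δ ⊢ → Γ ⨾ Δ ⊢
  dp-sw  : ∀ {Γ Δ} → Γ ⨾ Δ ⊢ → Δ ⨾ Γ ⊢
  dp-⊖   : ∀ {Γ Δ Θ} → (Γ ·⊗· Δ) ⨾ Θ ⊢ → Γ ⨾ (Δ ·⊖· Θ) ⊢
  dp-⊖⁻  : ∀ {Γ Δ Θ} → Γ ⨾ (Δ ·⊖· Θ) ⊢ → (Γ ·⊗· Δ) ⨾ Θ ⊢
  dp-⊘   : ∀ {Γ Δ Θ} → Γ ⨾ (Δ ·⊗· Θ) ⊢ → (Γ ·⊘· Δ) ⨾ Θ ⊢
  dp-⊘⁻  : ∀ {Γ Δ Θ} → (Γ ·⊘· Δ) ⨾ Θ ⊢ → Γ ⨾ (Δ ·⊗· Θ) ⊢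
  r⊗  : ∀ {Γ A B} → Γ ⨾ (⌊ A ⌋ ·⊗· ⌊ B ⌋) ⊢ → Γ ⨾ ⌊ A ⊗ B ⌋ ⊢
  r⊖  : ∀ {Γ A B} → Γ ⨾ (⌊ B ᗮ ⌋ ·⊖· ⌊ A ⌋) ⊢ → Γ ⨾ ⌊ B ⊖ A ⌋ ⊢
  r⊘  : ∀ {Γ A B} → Γ ⨾ (⌊ A ⌋ ·⊘· ⌊ B ᗮ ⌋) ⊢ → Γ ⨾ ⌊ A ⊘ B ⌋ ⊢
  r∨  : ∀ {Γ A B} → Γ ⨾ ⌊ A ⌋ ⊢ → Γ ⨾ ⌊ B ⌋ ⊢ → Γ ⨾ ⌊ A ∨ B ⌋ ⊢
  r⊕  : ∀ {Γ Δ A B} → Γ ⨾ ⌊ A ⌋ ⊢ → Δ ⨾ ⌊ B ⌋ ⊢ → (Γ ·⊗· Δ) ⨾ ⌊ B ⊕ A ⌋ ⊢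
  r/  : ∀ {Γ Δ A B} → Γ ⨾ ⌊ B ᗮ ⌋ ⊢ → Δ ⨾ ⌊ A ⌋ ⊢ → (Γ ·⊖· Δ) ⨾ ⌊ A / B ⌋ ⊢
  r⧵  : ∀ {Γ Δ A B} → Γ ⨾ ⌊ A ⌋ ⊢ → Δ ⨾ ⌊ B ᗮ ⌋ ⊢ → (Γ ·⊘· Δ) ⨾ ⌊ B ⧵ A ⌋ ⊢
  r∧₁ : ∀ {Γ A B} → Γ ⨾ ⌊ A ⌋ ⊢ → Γ ⨾ ⌊ A ∧ B ⌋ ⊢
  r∧₂ : ∀ {Γ A B} → Γ ⨾ ⌊ B ⌋ ⊢ → Γ ⨾ ⌊ A ∧ B ⌋ ⊢

infixr 30 _⊗⁺_ _⊘⁺_ _⊖⁺_ _∨⁺_ _⊕⁻_ _⧵⁻_ _/⁻_ _∧⁻_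

data Pos (At : Set) : Set
data Neg (At : Set) : Set

data Pos At where
  patom : At → Pos At
  _⊗⁺_  : Pos At → Pos At → Pos At
  _⊘⁺_  : Pos At → Neg At → Pos At
  _⊖⁺_  : Neg At → Pos At → Pos At
  _∨⁺_  : Pos At → Pos At → Pos At
  ↓     : Neg At → Pos At

data Neg At where
  natom : At → Neg At
  _⊕⁻_  : Neg At → Neg At → Neg At
  _⧵⁻_  : Pos At → Neg At → Neg At
  _/⁻_  : Neg At → Pos At → Neg At
  _∧⁻_  : Neg At → Neg At → Neg At
  ↑     : Pos At → Neg At

_ᗮ⁺ : ∀ {At} → Pos At → Neg At
_ᗮ⁻ : ∀ {At} → Neg At → Pos At

patom p ᗮ⁺  = natom p
(P ⊗⁺ Q) ᗮ⁺ = (Q ᗮ⁺) ⊕⁻ (P ᗮ⁺)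
(N ⊖⁺ P) ᗮ⁺ = (P ᗮ⁺) /⁻ (N ᗮ⁻)
(P ⊘⁺ N) ᗮ⁺ = (N ᗮ⁻) ⧵⁻ (P ᗮ⁺)
(P ∨⁺ Q) ᗮ⁺ = (Q ᗮ⁺) ∧⁻ (P ᗮ⁺)
↓ N ᗮ⁺      = ↑ (N ᗮ⁻)

natom p ᗮ⁻  = patom p
(M ⊕⁻ N) ᗮ⁻ = (N ᗮ⁻) ⊗⁺ (M ᗮ⁻)
(M /⁻ Q) ᗮ⁻ = (Q ᗮ⁺) ⊖⁺ (M ᗮ⁻)
(Q ⧵⁻ M) ᗮ⁻ = (M ᗮ⁻) ⊘⁺ (Q ᗮ⁺)
(M ∧⁻ N) ᗮ⁻ = (N ᗮ⁻) ∨⁺ (M ᗮ⁻)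
↑ P ᗮ⁻      = ↓ (P ᗮ⁺)

data FStr (At : Set) : Set where
  fatom  : At → FStr At
  fneg   : Neg At → FStr At
  _f⊗_   : FStr At → FStr At → FStr At
  _f⊘_   : FStr At → FStr At → FStr At
  _f⊖_   : FStr At → FStr At → FStr At

data Inv {At : Set} : Pos At → FStr At → Set where
  inv-atom : ∀ {p} → Inv (patom p) (fatom p)
  inv-↓    : ∀ {N} → Inv (↓ N) (fneg N)
  inv-∨₁   : ∀ {P Q Π} → Inv P Π → Inv (P ∨⁺ Q) Π
  inv-∨₂   : ∀ {P Q Π} → Inv Q Π → Inv (P ∨⁺ Q) Π
  inv-⊗    : ∀ {P Q Π Σ} → Inv P Π → Inv Q Σ → Inv (P ⊗⁺ Q) (Π f⊗ Σ)
  inv-⊘    : ∀ {P N Π Σ} → Inv P Π → Inv (N ᗮ⁻) Σ → Inv (P ⊘⁺ N) (Π f⊘ Σ)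
  inv-⊖    : ∀ {P N Π Σ} → Inv P Π → Inv (N ᗮ⁻) Σ → Inv (N ⊖⁺ P) (Σ f⊖ Π)

∣_∣⁺ : ∀ {At} → Pos At → Fm At
∣_∣⁻ : ∀ {At} → Neg At → Fm At

∣ patom p ∣⁺  = at p
∣ P ⊗⁺ Q ∣⁺   = ∣ P ∣⁺ ⊗ ∣ Q ∣⁺
∣ N ⊖⁺ P ∣⁺   = ∣ N ∣⁻ ⊖ ∣ P ∣⁺
∣ P ⊘⁺ N ∣⁺   = ∣ P ∣⁺ ⊘ ∣ N ∣⁻
∣ P ∨⁺ Q ∣⁺   = ∣ P ∣⁺ ∨ ∣ Q ∣⁺
∣ ↓ N ∣⁺      = ∣ N ∣⁻

∣ natom p ∣⁻  = nat p
∣ M ⊕⁻ N ∣⁻   = ∣ M ∣⁻ ⊕ ∣ N ∣⁻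
∣ M /⁻ Q ∣⁻   = ∣ M ∣⁻ / ∣ Q ∣⁺
∣ Q ⧵⁻ M ∣⁻   = ∣ Q ∣⁺ ⧵ ∣ M ∣⁻
∣ M ∧⁻ N ∣⁻   = ∣ M ∣⁻ ∧ ∣ N ∣⁻
∣ ↑ P ∣⁻      = ∣ P ∣⁺

∣_∣ˢ : ∀ {At} → FStr At → Str At
∣ fatom p ∣ˢ = ⌊ at p ⌋
∣ fneg N ∣ˢ  = ⌊ ∣ N ∣⁻ ⌋
∣ Π f⊗ Σ ∣ˢ  = ∣ Π ∣ˢ ·⊗· ∣ Σ ∣ˢ
∣ Π f⊘ Σ ∣ˢ  = ∣ Π ∣ˢ ·⊘· ∣ Σ ∣ˢ
∣ Σ f⊖ Π ∣ˢ  = ∣ Σ ∣ˢ ·⊖· ∣ Π ∣ˢ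

{-# OPTIONS --safe #-}
module Submission where

-- Induction on P. Each positive connective has an invertible rule, and the
-- display postulates let either argument of a structural connective be
-- isolated, so the inversion rules of the two immediate subformulas can be
-- applied one argument at a time. For ⊘ and ⊖ the second subformula enters
-- inv(P) through its dual N ᗮ⁻, which is not a subterm of P; hence the
-- induction runs simultaneously over negative formulas N, proving the claim
-- for N ᗮ⁻, and relies on negation being involutive and commuting with ∣_∣.

open import Defs
open import Function.Base using (_∘_)
open import Function.Bundles using (_⇔_; mk⇔; Equivalence)
open import Relation.Binary.PropositionalEquality
  using (_≡_; refl; cong; cong₂; sym; subst; subst₂)

module _ {At : Set} where

  ᗮ-involutive : (A : Fm At) → A ᗮ ᗮ ≡ A
  ᗮ-involutive (at p)  = refl
  ᗮ-involutive (nat p) = refl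
  ᗮ-involutive (A ⊗ B) = cong₂ _⊗_ (ᗮ-involutive A) (ᗮ-involutive B)
  ᗮ-involutive (A ⊕ B) = cong₂ _⊕_ (ᗮ-involutive A) (ᗮ-involutive B)
  ᗮ-involutive (A / B) = cong₂ _/_ (ᗮ-involutive A) (ᗮ-involutive B)
  ᗮ-involutive (A ⊖ B) = cong₂ _⊖_ (ᗮ-involutive A) (ᗮ-involutive B)
  ᗮ-involutive (A ⧵ B) = cong₂ _⧵_ (ᗮ-involutive A) (ᗮ-involutive B)
  ᗮ-involutive (A ⊘ B) = cong₂ _⊘_ (ᗮ-involutive A) (ᗮ-involutive B)
  ᗮ-involutive (A ∧ B) = cong₂ _∧_ (ᗮ-involutive A) (ᗮ-involutive B)
  ᗮ-involutive (A ∨ B) = cong₂ _∨_ (ᗮ-involutive A) (ᗮ-involutive B)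

  ᗮ⁺-involutive : (P : Pos At) → P ᗮ⁺ ᗮ⁻ ≡ P
  ᗮ⁻-involutive : (N : Neg At) → N ᗮ⁻ ᗮ⁺ ≡ N

  ᗮ⁺-involutive (patom p) = refl
  ᗮ⁺-involutive (P ⊗⁺ Q)  = cong₂ _⊗⁺_ (ᗮ⁺-involutive P) (ᗮ⁺-involutive Q)
  ᗮ⁺-involutive (P ⊘⁺ N)  = cong₂ _⊘⁺_ (ᗮ⁺-involutive P) (ᗮ⁻-involutive N)
  ᗮ⁺-involutive (N ⊖⁺ P)  = cong₂ _⊖⁺_ (ᗮ⁻-involutive N) (ᗮ⁺-involutive P)
  ᗮ⁺-involutive (P ∨⁺ Q)  = cong₂ _∨⁺_ (ᗮ⁺-involutive P) (ᗮ⁺-involutive Q)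
  ᗮ⁺-involutive (↓ N)     = cong ↓ (ᗮ⁻-involutive N)

  ᗮ⁻-involutive (natom p) = refl
  ᗮ⁻-involutive (M ⊕⁻ N)  = cong₂ _⊕⁻_ (ᗮ⁻-involutive M) (ᗮ⁻-involutive N)
  ᗮ⁻-involutive (Q ⧵⁻ M)  = cong₂ _⧵⁻_ (ᗮ⁺-involutive Q) (ᗮ⁻-involutive M)
  ᗮ⁻-involutive (M /⁻ Q)  = cong₂ _/⁻_ (ᗮ⁻-involutive M) (ᗮ⁺-involutive Q)
  ᗮ⁻-involutive (M ∧⁻ N)  = cong₂ _∧⁻_ (ᗮ⁻-involutive M) (ᗮ⁻-involutive N)
  ᗮ⁻-involutive (↑ P)     = cong ↑ (ᗮ⁺-involutive P)

  ∣ᗮ⁺∣⁻≡∣∣⁺ᗮ : (P : Pos At) → ∣ P ᗮ⁺ ∣⁻ ≡ ∣ P ∣⁺ ᗮ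
  ∣ᗮ⁻∣⁺≡∣∣⁻ᗮ : (N : Neg At) → ∣ N ᗮ⁻ ∣⁺ ≡ ∣ N ∣⁻ ᗮ

  ∣ᗮ⁺∣⁻≡∣∣⁺ᗮ (patom p) = refl
  ∣ᗮ⁺∣⁻≡∣∣⁺ᗮ (P ⊗⁺ Q)  = cong₂ _⊕_ (∣ᗮ⁺∣⁻≡∣∣⁺ᗮ Q) (∣ᗮ⁺∣⁻≡∣∣⁺ᗮ P)
  ∣ᗮ⁺∣⁻≡∣∣⁺ᗮ (P ⊘⁺ N)  = cong₂ _⧵_ (∣ᗮ⁻∣⁺≡∣∣⁻ᗮ N) (∣ᗮ⁺∣⁻≡∣∣⁺ᗮ P)
  ∣ᗮ⁺∣⁻≡∣∣⁺ᗮ (N ⊖⁺ P)  = cong₂ _/_ (∣ᗮ⁺∣⁻≡∣∣⁺ᗮ P) (∣ᗮ⁻∣⁺≡∣∣⁻ᗮ N)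
  ∣ᗮ⁺∣⁻≡∣∣⁺ᗮ (P ∨⁺ Q)  = cong₂ _∧_ (∣ᗮ⁺∣⁻≡∣∣⁺ᗮ Q) (∣ᗮ⁺∣⁻≡∣∣⁺ᗮ P)
  ∣ᗮ⁺∣⁻≡∣∣⁺ᗮ (↓ N)     = ∣ᗮ⁻∣⁺≡∣∣⁻ᗮ N

  ∣ᗮ⁻∣⁺≡∣∣⁻ᗮ (natom p) = refl
  ∣ᗮ⁻∣⁺≡∣∣⁻ᗮ (M ⊕⁻ N)  = cong₂ _⊗_ (∣ᗮ⁻∣⁺≡∣∣⁻ᗮ N) (∣ᗮ⁻∣⁺≡∣∣⁻ᗮ M)
  ∣ᗮ⁻∣⁺≡∣∣⁻ᗮ (Q ⧵⁻ M)  = cong₂ _⊘_ (∣ᗮ⁻∣⁺≡∣∣⁻ᗮ M) (∣ᗮ⁺∣⁻≡∣∣⁺ᗮ Q)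
  ∣ᗮ⁻∣⁺≡∣∣⁻ᗮ (M /⁻ Q)  = cong₂ _⊖_ (∣ᗮ⁺∣⁻≡∣∣⁺ᗮ Q) (∣ᗮ⁻∣⁺≡∣∣⁻ᗮ M)
  ∣ᗮ⁻∣⁺≡∣∣⁻ᗮ (M ∧⁻ N)  = cong₂ _∨_ (∣ᗮ⁻∣⁺≡∣∣⁻ᗮ N) (∣ᗮ⁻∣⁺≡∣∣⁻ᗮ M)
  ∣ᗮ⁻∣⁺≡∣∣⁻ᗮ (↑ P)     = ∣ᗮ⁺∣⁻≡∣∣⁺ᗮ P

  record Display (F : Str At → Str At → Str At) : Set where
    field
      contextˡ : Str At → Str At → Str At
      displayˡ : ∀ {Γ Δ Θ} → (Γ ⨾ F Δ Θ ⊢) ⇔ (contextˡ Γ Θ ⨾ Δ ⊢)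
      contextʳ : Str At → Str At → Str At
      displayʳ : ∀ {Γ Δ Θ} → (Γ ⨾ F Δ Θ ⊢) ⇔ (contextʳ Γ Δ ⨾ Θ ⊢)

  display-⊗ : Display _·⊗·_
  display-⊗ = record
    { contextˡ = λ Γ Θ → Θ ·⊖· Γ
    ; displayˡ = mk⇔ (dp-sw ∘ dp-⊖ ∘ dp-sw) (dp-sw ∘ dp-⊖⁻ ∘ dp-sw)
    ; contextʳ = _·⊘·_
    ; displayʳ = mk⇔ dp-⊘ dp-⊘⁻
    }

  display-⊘ : Display _·⊘·_
  display-⊘ = record
    { contextˡ = λ Γ Θ → Θ ·⊗· Γ
    ; displayˡ = mk⇔ (dp-sw ∘ dp-⊘⁻ ∘ dp-sw) (dp-sw ∘ dp-⊘ ∘ dp-sw)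
    ; contextʳ = _·⊖·_
    ; displayʳ = mk⇔ (dp-sw ∘ dp-⊖ ∘ dp-sw ∘ dp-⊘⁻ ∘ dp-sw)
                     (dp-sw ∘ dp-⊘ ∘ dp-sw ∘ dp-⊖⁻ ∘ dp-sw)
    }

  display-⊖ : Display _·⊖·_
  display-⊖ = record
    { contextˡ = λ Γ Θ → Θ ·⊘· Γ
    ; displayˡ = mk⇔ (dp-⊘ ∘ dp-sw ∘ dp-⊖⁻) (dp-⊖ ∘ dp-sw ∘ dp-⊘⁻)
    ; contextʳ = _·⊗·_
    ; displayʳ = mk⇔ dp-⊖⁻ dp-⊖
    }

  InvAdmissible : Pos At → Fm At → Set
  InvAdmissible P A = ∀ Γ → (∀ Σ → Inv P Σ → Γ ⨾ ∣ Σ ∣ˢ ⊢) → Γ ⨾ ⌊ A ⌋ ⊢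

  module _ {F : Str At → Str At → Str At} (D : Display F) where
    open Display D
    open Equivalence

    invAdmissibleˡ : ∀ {P A Γ Θ} → InvAdmissible P A →
      (∀ Π → Inv P Π → Γ ⨾ F ∣ Π ∣ˢ Θ ⊢) → Γ ⨾ F ⌊ A ⌋ Θ ⊢
    invAdmissibleˡ adm h =
      from displayˡ (adm _ (λ Π i → to displayˡ (h Π i)))

    invAdmissibleʳ : ∀ {Q B Γ Δ} → InvAdmissible Q B →
      (∀ Σ → Inv Q Σ → Γ ⨾ F Δ ∣ Σ ∣ˢ ⊢) → Γ ⨾ F Δ ⌊ B ⌋ ⊢
    invAdmissibleʳ adm h =
      from displayʳ (adm _ (λ Σ i → to displayʳ (h Σ i)))

    invAdmissible₂ : ∀ {P Q A B Γ} → InvAdmissible P A → InvAdmissible Q B →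
      (∀ Π Σ → Inv P Π → Inv Q Σ → Γ ⨾ F ∣ Π ∣ˢ ∣ Σ ∣ˢ ⊢) →
      Γ ⨾ F ⌊ A ⌋ ⌊ B ⌋ ⊢
    invAdmissible₂ admP admQ h =
      invAdmissibleʳ admQ (λ Σ j → invAdmissibleˡ admP (λ Π i → h Π Σ i j))

  invAdmissible-atom : ∀ p → InvAdmissible (patom p) (at p)
  invAdmissible-atom p Γ h = h (fatom p) inv-atom

  invAdmissible-⊗ : ∀ {P Q A B} → InvAdmissible P A → InvAdmissible Q B →
    InvAdmissible (P ⊗⁺ Q) (A ⊗ B)
  invAdmissible-⊗ admP admQ Γ h =
    r⊗ (invAdmissible₂ display-⊗ admP admQ (λ Π Σ i j → h _ (inv-⊗ i j)))

  invAdmissible-⊘ : ∀ {P N A B} → InvAdmissible P A → InvAdmissible (N ᗮ⁻) (B ᗮ) →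
    InvAdmissible (P ⊘⁺ N) (A ⊘ B)
  invAdmissible-⊘ admP admN Γ h =
    r⊘ (invAdmissible₂ display-⊘ admP admN (λ Π Σ i j → h _ (inv-⊘ i j)))

  invAdmissible-⊖ : ∀ {P N A B} → InvAdmissible (N ᗮ⁻) (B ᗮ) → InvAdmissible P A →
    InvAdmissible (N ⊖⁺ P) (B ⊖ A)
  invAdmissible-⊖ admN admP Γ h =
    r⊖ (invAdmissible₂ display-⊖ admN admP (λ Σ Π j i → h _ (inv-⊖ i j)))

  invAdmissible-∨ : ∀ {P Q A B} → InvAdmissible P A → InvAdmissible Q B →
    InvAdmissible (P ∨⁺ Q) (A ∨ B)
  invAdmissible-∨ admP admQ Γ h =
    r∨ (admP Γ (λ Σ i → h Σ (inv-∨₁ i))) (admQ Γ (λ Σ i → h Σ (inv-∨₂ i)))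

  invAdmissible-∣∣⁺ : (P : Pos At) → InvAdmissible P ∣ P ∣⁺
  invAdmissible-∣∣⁻ᗮ : (N : Neg At) → InvAdmissible (N ᗮ⁻) (∣ N ∣⁻ ᗮ)
  invAdmissible-∣∣⁺ᗮᗮ : (P : Pos At) → InvAdmissible (P ᗮ⁺ ᗮ⁻) (∣ P ∣⁺ ᗮ ᗮ)

  invAdmissible-∣∣⁺ (patom p) = invAdmissible-atom p
  invAdmissible-∣∣⁺ (P ⊗⁺ Q)  = invAdmissible-⊗ (invAdmissible-∣∣⁺ P) (invAdmissible-∣∣⁺ Q)
  invAdmissible-∣∣⁺ (P ⊘⁺ N)  = invAdmissible-⊘ (invAdmissible-∣∣⁺ P) (invAdmissible-∣∣⁻ᗮ N)
  invAdmissible-∣∣⁺ (N ⊖⁺ P)  = invAdmissible-⊖ (invAdmissible-∣∣⁻ᗮ N) (invAdmissible-∣∣⁺ P)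
  invAdmissible-∣∣⁺ (P ∨⁺ Q)  = invAdmissible-∨ (invAdmissible-∣∣⁺ P) (invAdmissible-∣∣⁺ Q)
  invAdmissible-∣∣⁺ (↓ N) Γ h = h (fneg N) inv-↓

  invAdmissible-∣∣⁻ᗮ (natom p) = invAdmissible-atom p
  invAdmissible-∣∣⁻ᗮ (M ⊕⁻ N)  = invAdmissible-⊗ (invAdmissible-∣∣⁻ᗮ N) (invAdmissible-∣∣⁻ᗮ M)
  invAdmissible-∣∣⁻ᗮ (Q ⧵⁻ M)  = invAdmissible-⊘ (invAdmissible-∣∣⁻ᗮ M) (invAdmissible-∣∣⁺ᗮᗮ Q)
  invAdmissible-∣∣⁻ᗮ (M /⁻ Q)  = invAdmissible-⊖ (invAdmissible-∣∣⁺ᗮᗮ Q) (invAdmissible-∣∣⁻ᗮ M)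
  invAdmissible-∣∣⁻ᗮ (M ∧⁻ N)  = invAdmissible-∨ (invAdmissible-∣∣⁻ᗮ N) (invAdmissible-∣∣⁻ᗮ M)
  invAdmissible-∣∣⁻ᗮ (↑ P) Γ h =
    subst (λ A → Γ ⨾ ⌊ A ⌋ ⊢) (∣ᗮ⁺∣⁻≡∣∣⁺ᗮ P) (h (fneg (P ᗮ⁺)) inv-↓)

  invAdmissible-∣∣⁺ᗮᗮ P =
    subst₂ InvAdmissible (sym (ᗮ⁺-involutive P)) (sym (ᗮ-involutive ∣ P ∣⁺))
      (invAdmissible-∣∣⁺ P)

lemma38 : {At : Set} (P : Pos At) (Γ : Str At) →
    ((Σ : FStr At) → Inv P Σ → Γ ⨾ ∣ Σ ∣ˢ ⊢) →
    Γ ⨾ ⌊ ∣ P ∣⁺ ⌋ ⊢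
lemma38 P = invAdmissible-∣∣⁺ P
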